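{- Let $\tau$ be a binary tubing of a plane rooted tree $t$ and $C=\theta(\tau)$, with $\theta$ defined below and with the induced correspondence between vertices of $t$ and chords of $C$. Then the set of terminal chords of $C$ corresponds to the set consisting of the root of $t$ together with all vertices of $t$ that are the root of at least one tube of $\tau$ containing two or more vertices.
   Context: A plane rooted tree is a root with an ordered list of plane rooted trees as children. A tube is a vertex set inducing a connected subgraph; a binary tubing $\tau$ of $t$ is a set of tubes containing $V(t)$ such that each tube is a single vertex or is partitioned by two other tubes; the root of a tube is its vertex nearest the root of $t$. If $t$ has $\ge2$ vertices, the two tubes partitioning $V(t)$ are the vertex sets of a rooted subtree $t'$ (a non-root vertex and its descendants) and $t''=t\setminus t'$, with induced tubings $\tau',\tau''$. RTIPs of a plane rooted tree: at each vertex a place before the first child, between consecutive children, after the last child; ordered recursively: for root with subtrees $t_1,\dots,t_k$: place before $t_1$, places of $t_1$, place between $t_1,t_2$, ..., place after $t_k$. A rooted chord diagram of size $n$ is a set of pairs $(a_j,b_j)$, $a_j<b_j$, partitioning $\{1,\dots,2n\}$; root chord has $a_j=1$. A chord $(a,b)$ is terminal if there is no chord $(a',b')$ with $a<a'<b<b'$. $\theta$: the one-vertex tubing maps to the one-chord diagram, its chord corresponding to the vertex. Otherwise let $C''=\theta(\tau'')$ (size $n''$), $C'=\theta(\tau')$ (size $m$, root chord $(1,k)$), with $t'$ attached to $t''$ at its $i$-th RTIP. Then $\theta(\tau)$ has points $\{1,\dots,2n''+2m\}$ and chords $(1,k+i)$; $(a+i,b+i)$ for each non-root chord $(a,b)$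 of $C'$; and each chord of $C''$ with each endpoint $p$ replaced by $p+1$ if $p\le i$ and by $p+2m$ if $p>i$. The vertex–chord correspondence for $\tau$ is inherited: vertices of $t'$ (resp. $t''$) correspond to the images of their chords in $C'$ (resp. $C''$). -}

module Defs where

open import Data.Nat using (ℕ; zero; suc; _+_; _*_; _≤_; _<_; _≟_; _≤?_)
open import Data.List using (List; []; _∷_; _++_; map; length; concat)
open import Data.List.Membership.Propositional using (_∈_)
open import Data.List.Relation.Unary.Unique.Propositional using (Unique)
open import Data.Product using (Σ; ∃; ∃-syntax; _×_; _,_)
open import Data.Sum using (_⊎_)
open import Relation.Nullary using (¬_; yes; no)
open import Relation.Binary.PropositionalEquality using (_≡_)

-- Labels identify vertices; we require them to be pairwise distinct.

data PTree : Set where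
  node : ℕ → List PTree → PTree

rootLabel : PTree → ℕ
rootLabel (node x _) = x

mutual
  labels : PTree → List ℕ
  labels (node x ts) = x ∷ labelsF ts

  labelsF : List PTree → List ℕ
  labelsF []       = []
  labelsF (t ∷ ts) = labels t ++ labelsF ts

-- number of RTIPs of a tree (= 2·|V| - 1)
mutual
  rtips : PTree → ℕ
  rtips (node _ ts) = rtipsF ts

  -- places of a children list: before first child, places of each child,
  -- between consecutive children, after last child
  rtipsF : List PTree → ℕ
  rtipsF []       = 1
  rtipsF (u ∷ ts) = 1 + rtips u + rtipsF ts

-- Ins s t'' i t : t is obtained from t'' by attaching the tree s
-- (as a new child) at the i-th RTIP of t'' (1-based, in the recursive
-- order of the paper).

mutual
  data Ins (s : PTree) : PTree → ℕ → PTree → Set where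
    atNode : ∀ {x ts i ts'} → InsF s ts i ts' → Ins s (node x ts) i (node x ts')

  data InsF (s : PTree) : List PTree → ℕ → List PTree → Set where
    -- the place before the first child (or the only place, or the place
    -- after the last child when reached through 'later')
    here   : ∀ {ts} → InsF s ts 1 (s ∷ ts)
    inside : ∀ {u u' ts i} → Ins s u i u' → InsF s (u ∷ ts) (1 + i) (u' ∷ ts)
    later  : ∀ {u ts ts' i} → InsF s ts i ts' → InsF s (u ∷ ts) (1 + rtips u + i) (u ∷ ts')

-- Binary tubings, given by their (unique) recursive decomposition:
-- a single vertex, or V(t) partitioned into the tubes V(t') and V(t''),
-- where t' is the rooted subtree at a non-root vertex of t, attached to
-- t'' = t ∖ t' at its i-th RTIP, with binary tubings τ' of t', τ'' of t''.

data BinTubing : PTree → Set where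
  single : ∀ x → BinTubing (node x [])
  split  : ∀ {t' t'' i t} → Ins t' t'' i t →
           BinTubing t' → BinTubing t'' → BinTubing t

tubes : ∀ {t} → BinTubing t → List (List ℕ)
tubes (single x)                 = (x ∷ []) ∷ []
tubes (split {t = t} _ τ' τ'')   = labels t ∷ (tubes τ' ++ tubes τ'')

data Depth : PTree → ℕ → ℕ → Set where
  root  : ∀ {x ts} → Depth (node x ts) x 0
  below : ∀ {x ts u y d} → u ∈ ts → Depth u y d → Depth (node x ts) y (suc d)

IsTubeRoot : PTree → List ℕ → ℕ → Set
IsTubeRoot t T x =
  x ∈ T × Σ ℕ λ dx → Depth t x dx × (∀ y dy → y ∈ T → Depth t y dy → dx ≤ dy)

-- Rooted chord diagrams: a chord is (vertex label , a , b) with a < b.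

Chord : Set
Chord = ℕ × ℕ × ℕ

-- second endpoint of the root chord (the chord with a = 1)
rootEnd : List Chord → ℕ
rootEnd []                  = 0
rootEnd ((_ , a , b) ∷ cs) with a ≟ 1
... | yes _ = b
... | no  _ = rootEnd cs

mutual
  θ : ∀ {t} → BinTubing t → List Chord
  θ (single x) = (x , 1 , 2) ∷ []
  θ (split {i = i} _ τ' τ'') =
    map (shiftC' (rootEnd (θ τ')) i) (θ τ') ++
    map (shiftC'' i (length (θ τ'))) (θ τ'')

  shiftC' : ℕ → ℕ → Chord → Chord
  shiftC' k i (x , a , b) with a ≟ 1
  ... | yes _ = (x , 1 , k + i)
  ... | no  _ = (x , a + i , b + i)

  shiftP : ℕ → ℕ → ℕ → ℕ
  shiftP i m p with p ≤? i
  ... | yes _ = p + 1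
  ... | no  _ = p + 2 * m

  shiftC'' : ℕ → ℕ → Chord → Chord
  shiftC'' i m (x , a , b) = (x , shiftP i m a , shiftP i m b)

Terminal : List Chord → Chord → Set
Terminal C (_ , a , b) =
  ¬ (Σ Chord λ { (y , a' , b') → (y , a' , b') ∈ C × a < a' × a' < b × b < b' })

TerminalLabel : List Chord → ℕ → Set
TerminalLabel C x = Σ ℕ λ a → Σ ℕ λ b → (x , a , b) ∈ C × Terminal C (x , a , b)

module Submission where

-- Write C' = θ(τ'), C'' = θ(τ'') and m = |C'|, so that θ(τ) = graft i C' C''.  The non-root
-- chords of C' are moved by p ↦ p + i into the interval [2 + i, 2m + i], while shiftP moves
-- every point of C'' outside it.  Both maps are strictly increasing, hence preserve and reflect
-- crossings, and a chord inside an interval never crosses one with both ends outside it; so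
-- these chords are terminal in θ(τ) exactly when they were terminal in C' or C''.  The root
-- chord of C' becomes (1, k + i) and is crossed by the image of a chord of C'' covering the
-- point i, which exists because the diagrams produced by θ are indecomposable.  On the tubing
-- side, the tubes of τ are V(t), rooted at the root of t (= the root of t''), and the tubes of
-- τ' and τ'', whose roots do not change because t' and t'' sit in t with a constant depth
-- shift.

open import Defs
open import Data.Nat
open import Data.Nat.Properties
open import Data.List using (List; []; _∷_; _++_; map; length; [_])
open import Data.List.Properties using (++-assoc; length-++; length-map; map-cong-local)
open import Data.List.Membership.Propositional using (_∈_)
open import Data.List.Membership.Propositional.Properties using (∈-++⁻; ∈-++⁺ˡ; ∈-++⁺ʳ; ∈-map⁺; ∈-map⁻)
open import Data.List.Relation.Unary.Any using (here; there)
open import Data.List.Relation.Unary.All as All using (All; []; _∷_) renaming (lookup to lookupᴬ)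
import Data.List.Relation.Unary.All.Properties as All
open import Data.List.Relation.Unary.AllPairs using ([]; _∷_)
open import Data.List.Relation.Unary.Unique.Propositional using (Unique)
open import Data.Product using (Σ; ∃-syntax; _×_; _,_; proj₁; proj₂)
open import Data.Sum using (_⊎_; inj₁; inj₂)
open import Data.Sum.Function.Propositional using (_⊎-⇔_)
open import Data.Empty using (⊥; ⊥-elim)
open import Function.Bundles using (_⇔_; mk⇔; Equivalence)
open import Function.Properties.Equivalence using () renaming (sym to ⇔-sym; trans to ⇔-trans)
open import Function.Related.Propositional using (module EquationalReasoning)
open import Relation.Binary.Core using (_Preserves_⟶_)
open import Relation.Binary.PropositionalEquality
  using (_≡_; refl; sym; trans; cong; cong₂; subst; subst₂; module ≡-Reasoning)
open import Relation.Nullary using (¬_; yes; no; contradiction)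

Covers : Chord → ℕ → Set
Covers (_ , a , b) j = a ≤ j × j < b

CrossedBy : Chord → Chord → Set
CrossedBy (_ , a , b) (_ , a' , b') = a < a' × a' < b × b < b'

Within : ℕ → ℕ → Chord → Set
Within lo hi (_ , a , b) = lo ≤ a × b ≤ hi

Outside : ℕ → ℕ → ℕ → Set
Outside lo hi p = p < lo ⊎ hi < p

Avoids : ℕ → ℕ → Chord → Set
Avoids lo hi (_ , a , b) = Outside lo hi a × Outside lo hi b

start : Chord → ℕ
start (_ , a , _) = a

mapEnds : (ℕ → ℕ) → Chord → Chord
mapEnds φ (y , a , b) = (y , φ a , φ b)

TerminalLabelIn : List Chord → List Chord → ℕ → Set
TerminalLabelIn A C x = Σ ℕ λ a → Σ ℕ λ b → (x , a , b) ∈ A × Terminal C (x , a , b)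

strictMono-reflects-< : ∀ {φ m n} → φ Preserves _<_ ⟶ _<_ → φ m < φ n → m < n
strictMono-reflects-< {φ} {m} {n} mono φm<φn with <-≤-connex m n
... | inj₁ m<n = m<n
... | inj₂ n≤m with m≤n⇒m<n∨m≡n n≤m
...   | inj₁ n<m = ⊥-elim (<-asym φm<φn (mono n<m))
...   | inj₂ refl = ⊥-elim (<-irrefl refl φm<φn)

terminal-++⁺ : ∀ A {B} c → Terminal A c → Terminal B c → Terminal (A ++ B) c
terminal-++⁺ A _ tA tB (c' , c'∈ , crossing) with ∈-++⁻ A c'∈
... | inj₁ c'∈A = tA (c' , c'∈A , crossing)
... | inj₂ c'∈B = tB (c' , c'∈B , crossing)

terminal-++⁻ˡ : ∀ A {B} c → Terminal (A ++ B) c → Terminal A c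
terminal-++⁻ˡ A _ t (c' , c'∈ , crossing) = t (c' , ∈-++⁺ˡ c'∈ , crossing)

terminal-++⁻ʳ : ∀ A {B} c → Terminal (A ++ B) c → Terminal B c
terminal-++⁻ʳ A _ t (c' , c'∈ , crossing) = t (c' , ∈-++⁺ʳ A c'∈ , crossing)

terminal-map⁺ : ∀ {φ A} c → φ Preserves _<_ ⟶ _<_ →
                Terminal A c → Terminal (map (mapEnds φ) A) (mapEnds φ c)
terminal-map⁺ {φ} _ mono t (c* , c*∈ , a<a' , a'<b , b<b') with ∈-map⁻ (mapEnds φ) c*∈
... | c' , c'∈ , refl =
  t (c' , c'∈ , strictMono-reflects-< mono a<a' , strictMono-reflects-< mono a'<b ,
                strictMono-reflects-< mono b<b')

terminal-map⁻ : ∀ {φ A} c → φ Preserves _<_ ⟶ _<_ →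
                Terminal (map (mapEnds φ) A) (mapEnds φ c) → Terminal A c
terminal-map⁻ {φ} _ mono t (c' , c'∈ , a<a' , a'<b , b<b') =
  t (mapEnds φ c' , ∈-map⁺ (mapEnds φ) c'∈ , mono a<a' , mono a'<b , mono b<b')

terminal-[_] : ∀ c' c → start c' ≤ start c → Terminal [ c' ] c
terminal-[ c' ] _ a'≤a (_ , here refl , a<a' , _) = <⇒≱ a<a' a'≤a

between⇒¬outside : ∀ {lo hi a b p} → lo ≤ a × b ≤ hi → a < p → p < b → ¬ Outside lo hi p
between⇒¬outside (lo≤a , _) a<p _ (inj₁ p<lo) = <-asym p<lo (≤-<-trans lo≤a a<p)
between⇒¬outside (_ , b≤hi) _ p<b (inj₂ hi<p) = <-asym hi<p (<-≤-trans p<b b≤hi)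

terminal-within : ∀ {lo hi B} c → Within lo hi c → All (Avoids lo hi) B → Terminal B c
terminal-within _ w avoid (_ , c'∈ , a<a' , a'<b , _) =
  between⇒¬outside w a<a' a'<b (proj₁ (lookupᴬ avoid c'∈))

terminal-avoids : ∀ {lo hi A} c → Avoids lo hi c → All (Within lo hi) A → Terminal A c
terminal-avoids _ (_ , b-outside) within (_ , c'∈ , _ , a'<b , b<b') =
  between⇒¬outside (lookupᴬ within c'∈) a'<b b<b' b-outside

terminalLabelIn-++ : ∀ A {B C x} →
  TerminalLabelIn (A ++ B) C x ⇔ (TerminalLabelIn A C x ⊎ TerminalLabelIn B C x)
terminalLabelIn-++ A = mk⇔ to from
  where
  to : ∀ {B C x} → TerminalLabelIn (A ++ B) C x → TerminalLabelIn A C x ⊎ TerminalLabelIn B C x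
  to (a , b , x∈ , t) with ∈-++⁻ A x∈
  ... | inj₁ x∈A = inj₁ (a , b , x∈A , t)
  ... | inj₂ x∈B = inj₂ (a , b , x∈B , t)
  from : ∀ {B C x} → TerminalLabelIn A C x ⊎ TerminalLabelIn B C x → TerminalLabelIn (A ++ B) C x
  from (inj₁ (a , b , x∈A , t)) = a , b , ∈-++⁺ˡ x∈A , t
  from (inj₂ (a , b , x∈B , t)) = a , b , ∈-++⁺ʳ A x∈B , t

terminalLabelIn-map : ∀ {φ A C E x} → (∀ {c} → c ∈ A → Terminal E (mapEnds φ c) ⇔ Terminal C c) →
  TerminalLabelIn (map (mapEnds φ) A) E x ⇔ TerminalLabelIn A C x
terminalLabelIn-map {φ} {A} {C} {E} {x} terminal⇔ = mk⇔ to from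
  where
  to : TerminalLabelIn (map (mapEnds φ) A) E x → TerminalLabelIn A C x
  to (_ , _ , x∈ , t) with ∈-map⁻ (mapEnds φ) x∈
  ... | (_ , a , b) , c∈ , refl = a , b , c∈ , Equivalence.to (terminal⇔ c∈) t
  from : TerminalLabelIn A C x → TerminalLabelIn (map (mapEnds φ) A) E x
  from (a , b , c∈ , t) = φ a , φ b , ∈-map⁺ (mapEnds φ) c∈ , Equivalence.from (terminal⇔ c∈) t

Indecomposable : List Chord → Set
Indecomposable C = ∀ j → 1 ≤ j → j < 2 * length C → ∃[ c ] c ∈ C × Covers c j

record Rooted (C : List Chord) : Set where
  field
    label end : ℕ
    rest : List Chord
    shape : C ≡ (label , 1 , end) ∷ rest
    end-bounds : 2 ≤ end × end ≤ 2 * suc (length rest)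
    rest-within : All (Within 2 (2 * suc (length rest))) rest
    indecomposable : Indecomposable ((label , 1 , end) ∷ rest)

module _ {C : List Chord} (R : Rooted C) where
  open Rooted R

  rooted-indecomposable : Indecomposable C
  rooted-indecomposable = subst Indecomposable (sym shape) indecomposable

  rooted-within : All (Within 1 (2 * length C)) C
  rooted-within = subst (λ E → All (Within 1 (2 * length E)) E) (sym shape)
    ((s≤s z≤n , proj₂ end-bounds) ∷ All.map (λ (2≤a , b≤) → <⇒≤ 2≤a , b≤) rest-within)

m≤n⇒∃[o]o+m≡n : ∀ {n j} → n ≤ j → ∃[ j' ] j' + n ≡ j
m≤n⇒∃[o]o+m≡n {n} {j} n≤j = j ∸ n , m∸n+n≡m n≤j

+-covers : ∀ {i c j} → Covers c j → Covers (mapEnds (_+ i) c) (j + i)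
+-covers {i} (a≤j , j<b) = +-monoˡ-≤ i a≤j , +-monoˡ-< i j<b

+-within : ∀ {i lo hi c} → Within lo hi c → Within (lo + i) (hi + i) (mapEnds (_+ i) c)
+-within {i} (lo≤a , b≤hi) = +-monoˡ-≤ i lo≤a , +-monoˡ-≤ i b≤hi

1≤m⇒1≤2*m : ∀ {m} → 1 ≤ m → 1 ≤ 2 * m
1≤m⇒1≤2*m {m} 1≤m = ≤-trans 1≤m (m≤m+n m _)

module _ {i m : ℕ} where

  shiftP-≤ : ∀ {p} → p ≤ i → shiftP i m p ≡ suc p
  shiftP-≤ {p} p≤i with p ≤? i
  ... | yes _   = +-comm p 1
  ... | no p≰i = contradiction p≤i p≰i

  shiftP-> : ∀ {p} → i < p → shiftP i m p ≡ p + 2 * m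
  shiftP-> {p} i<p with p ≤? i
  ... | yes p≤i = contradiction p≤i (<⇒≱ i<p)
  ... | no _    = refl

  shiftP-strictMono : 1 ≤ m → shiftP i m Preserves _<_ ⟶ _<_
  shiftP-strictMono 1≤m {p} {q} p<q with ≤-<-connex p i | ≤-<-connex q i
  ... | inj₁ p≤i | inj₁ q≤i rewrite shiftP-≤ p≤i | shiftP-≤ q≤i = s≤s p<q
  ... | inj₁ p≤i | inj₂ i<q rewrite shiftP-≤ p≤i | shiftP-> i<q =
    ≤-trans (+-mono-≤ (1≤m⇒1≤2*m 1≤m) p<q) (≤-reflexive (+-comm (2 * m) q))
  ... | inj₂ i<p | inj₁ q≤i = contradiction (≤-trans (<⇒≤ p<q) q≤i) (<⇒≱ i<p)
  ... | inj₂ i<p | inj₂ i<q rewrite shiftP-> i<p | shiftP-> i<q = +-monoˡ-< (2 * m) p<q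

  shiftP-outside : ∀ p → Outside (2 + i) (2 * m + i) (shiftP i m p)
  shiftP-outside p with ≤-<-connex p i
  ... | inj₁ p≤i rewrite shiftP-≤ p≤i = inj₁ (s≤s (s≤s p≤i))
  ... | inj₂ i<p rewrite shiftP-> i<p = inj₂ (<-≤-trans (+-monoʳ-< (2 * m) i<p) (≤-reflexive (+-comm (2 * m) p)))

  shiftP-avoids : ∀ c → Avoids (2 + i) (2 * m + i) (mapEnds (shiftP i m) c)
  shiftP-avoids (_ , a , b) = shiftP-outside a , shiftP-outside b

  shiftP-positive : 1 ≤ m → ∀ p → 1 ≤ shiftP i m p
  shiftP-positive 1≤m p with ≤-<-connex p i
  ... | inj₁ p≤i rewrite shiftP-≤ p≤i = s≤s z≤n
  ... | inj₂ i<p rewrite shiftP-> i<p = ≤-trans (1≤m⇒1≤2*m 1≤m) (m≤n+m _ p)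

  shiftP-within : ∀ {n c} → 1 ≤ m → i < n → Within 1 n c → Within 2 (2 * m + n) (mapEnds (shiftP i m) c)
  shiftP-within {n} {_ , a , b} 1≤m i<n (1≤a , b≤n) = lower , upper
    where
    lower : 2 ≤ shiftP i m a
    lower with ≤-<-connex a i
    ... | inj₁ a≤i rewrite shiftP-≤ a≤i = s≤s 1≤a
    ... | inj₂ i<a rewrite shiftP-> i<a = +-mono-≤ 1≤a (1≤m⇒1≤2*m 1≤m)
    upper : shiftP i m b ≤ 2 * m + n
    upper with ≤-<-connex b i
    ... | inj₁ b≤i rewrite shiftP-≤ b≤i = ≤-trans (<-≤-trans (s≤s b≤i) i<n) (m≤n+m n (2 * m))
    ... | inj₂ i<b rewrite shiftP-> i<b = ≤-trans (≤-reflexive (+-comm b (2 * m))) (+-monoʳ-≤ (2 * m) b≤n)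

  shiftP-covers : ∀ {c j} → 1 ≤ m → i ≤ j → Covers c j → Covers (mapEnds (shiftP i m) c) (j + 2 * m)
  shiftP-covers {_ , a , b} {j} 1≤m i≤j (a≤j , j<b) = a'≤ , <b'
    where
    a'≤ : shiftP i m a ≤ j + 2 * m
    a'≤ with ≤-<-connex a i
    ... | inj₁ a≤i rewrite shiftP-≤ a≤i = ≤-trans (≤-reflexive (+-comm 1 a)) (+-mono-≤ a≤j (1≤m⇒1≤2*m 1≤m))
    ... | inj₂ i<a rewrite shiftP-> i<a = +-monoˡ-≤ (2 * m) a≤j
    <b' : j + 2 * m < shiftP i m b
    <b' rewrite shiftP-> (≤-<-trans i≤j j<b) = +-monoˡ-< (2 * m) j<b

module Grafting (L k i : ℕ) (rest C'' : List Chord) where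

  C' : List Chord
  C' = (L , 1 , k) ∷ rest

  m : ℕ
  m = length C'

  inner outer : List Chord
  inner = map (mapEnds (_+ i)) rest
  outer = map (mapEnds (shiftP i m)) C''

  D : List Chord
  D = (L , 1 , k + i) ∷ inner ++ outer

  length-D : 2 * length D ≡ 2 * m + 2 * length C''
  length-D = begin
    2 * suc (length (inner ++ outer))      ≡⟨ cong (λ n → 2 * suc n) (length-++ inner) ⟩
    2 * suc (length inner + length outer)  ≡⟨ cong₂ (λ p q → 2 * suc (p + q)) (length-map _ rest) (length-map _ C'') ⟩
    2 * (m + length C'')                   ≡⟨ *-distribˡ-+ 2 m (length C'') ⟩
    2 * m + 2 * length C''                 ∎
    where open ≡-Reasoning

  inner-within : All (Within 2 (2 * m)) rest → All (Within (2 + i) (2 * m + i)) inner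
  inner-within w = All.map⁺ (All.map (λ {c} → +-within {i} {c = c}) w)

  outer-avoids : All (Avoids (2 + i) (2 * m + i)) outer
  outer-avoids = All.map⁺ (All.universal shiftP-avoids C'')

  root-nonterminal : 2 ≤ k → k ≤ 2 * m → Rooted C'' → 1 ≤ i → i < 2 * length C'' →
                     ¬ Terminal D (L , 1 , k + i)
  root-nonterminal 2≤k k≤2m R'' 1≤i i<n'' t
    with rooted-indecomposable R'' i 1≤i i<n''
  ... | c@(_ , p , q) , c∈ , p≤i , i<q =
    t (mapEnds (shiftP i m) c , there (∈-++⁺ʳ inner (∈-map⁺ _ c∈)) , 1<p' , p'<k+i , k+i<q')
    where
    1≤p : 1 ≤ p
    1≤p = proj₁ (lookupᴬ (rooted-within R'') c∈)
    1<p' : 1 < shiftP i m p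
    1<p' rewrite shiftP-≤ {m = m} p≤i = s≤s 1≤p
    p'<k+i : shiftP i m p < k + i
    p'<k+i rewrite shiftP-≤ {m = m} p≤i = +-mono-≤ 2≤k p≤i
    k+i<q' : k + i < shiftP i m q
    k+i<q' rewrite shiftP-> {m = m} i<q = <-≤-trans (+-mono-≤-< k≤2m i<q) (≤-reflexive (+-comm (2 * m) q))

  module _ (rest-within : All (Within 2 (2 * m)) rest) where

    inner-terminal : ∀ {c} → c ∈ rest → Terminal D (mapEnds (_+ i) c) ⇔ Terminal C' c
    inner-terminal {c@(_ , a , _)} c∈ = mk⇔ to from
      where
      c+i : Chord
      c+i = mapEnds (_+ i) c
      1≤a : 1 ≤ a
      1≤a = <⇒≤ (proj₁ (lookupᴬ rest-within c∈))
      to : Terminal D c+i → Terminal C' c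
      to t = terminal-++⁺ [ L , 1 , k ] c (terminal-[ L , 1 , k ] c 1≤a)
        (terminal-map⁻ c (+-monoˡ-< i) (terminal-++⁻ˡ inner c+i (terminal-++⁻ʳ [ L , 1 , k + i ] c+i t)))
      from : Terminal C' c → Terminal D c+i
      from t = terminal-++⁺ [ L , 1 , k + i ] c+i (terminal-[ L , 1 , k + i ] c+i (≤-trans 1≤a (m≤m+n a i)))
        (terminal-++⁺ inner c+i (terminal-map⁺ c (+-monoˡ-< i) (terminal-++⁻ʳ [ L , 1 , k ] c t))
          (terminal-within c+i (+-within {c = c} (lookupᴬ rest-within c∈)) outer-avoids))

    outer-terminal : ∀ c → Terminal D (mapEnds (shiftP i m) c) ⇔ Terminal C'' c
    outer-terminal c@(_ , a , _) = mk⇔ to from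
      where
      c* : Chord
      c* = mapEnds (shiftP i m) c
      to : Terminal D c* → Terminal C'' c
      to t = terminal-map⁻ c (shiftP-strictMono (s≤s z≤n))
        (terminal-++⁻ʳ inner c* (terminal-++⁻ʳ [ L , 1 , k + i ] c* t))
      from : Terminal C'' c → Terminal D c*
      from t = terminal-++⁺ [ L , 1 , k + i ] c* (terminal-[ L , 1 , k + i ] c* (shiftP-positive (s≤s z≤n) a))
        (terminal-++⁺ inner c* (terminal-avoids c* (shiftP-avoids c) (inner-within rest-within))
          (terminal-map⁺ c (shiftP-strictMono (s≤s z≤n)) t))

    terminalLabels : ∀ {x} → TerminalLabelIn (inner ++ outer) D x ⇔ (TerminalLabelIn rest C' x ⊎ TerminalLabel C'' x)
    terminalLabels = ⇔-trans (terminalLabelIn-++ inner)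
      (terminalLabelIn-map inner-terminal ⊎-⇔ terminalLabelIn-map (λ {c} _ → outer-terminal c))

  end-bounds : 2 ≤ k × k ≤ 2 * m → i < 2 * length C'' → 2 ≤ k + i × k + i ≤ 2 * length D
  end-bounds (2≤k , k≤2m) i<n'' =
    ≤-trans 2≤k (m≤m+n k i) , subst (k + i ≤_) (sym length-D) (+-mono-≤ k≤2m (<⇒≤ i<n''))

  rest-within : All (Within 2 (2 * m)) rest → Rooted C'' → i < 2 * length C'' →
                All (Within 2 (2 * length D)) (inner ++ outer)
  rest-within w R'' i<n'' = subst (λ n → All (Within 2 n) (inner ++ outer)) (sym length-D)
    (All.++⁺ (All.map (λ (2+i≤a , b≤2m+i) → ≤-trans (m≤m+n 2 i) 2+i≤a ,
                                             ≤-trans b≤2m+i (+-monoʳ-≤ (2 * m) (<⇒≤ i<n'')))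
                      (inner-within w))
             (All.map⁺ (All.map (λ {c} → shiftP-within {c = c} (s≤s z≤n) i<n'') (rooted-within R''))))

  covered-inside : 2 ≤ k → Indecomposable C' → ∀ j → k ≤ j → j < 2 * m → ∃[ c ] c ∈ D × Covers c (j + i)
  covered-inside 2≤k ind' j k≤j j<2m with ind' j (≤-trans (<⇒≤ 2≤k) k≤j) j<2m
  ... | _ , here refl , _ , j<k = contradiction k≤j (<⇒≱ j<k)
  ... | c , there c∈ , covers = mapEnds (_+ i) c , there (∈-++⁺ˡ (∈-map⁺ _ c∈)) , +-covers {c = c} covers

  covered-outside : Indecomposable C'' → 1 ≤ i → ∀ j → i ≤ j → j < 2 * length C'' →
                    ∃[ c ] c ∈ D × Covers c (j + 2 * m)
  covered-outside ind'' 1≤i j i≤j j<n'' with ind'' j (≤-trans 1≤i i≤j) j<n''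
  ... | c , c∈ , covers =
    mapEnds (shiftP i m) c , there (∈-++⁺ʳ inner (∈-map⁺ _ c∈)) , shiftP-covers {c = c} (s≤s z≤n) i≤j covers

  indecomposable : 2 ≤ k → Indecomposable C' → Indecomposable C'' → 1 ≤ i → Indecomposable D
  indecomposable 2≤k ind' ind'' 1≤i j 1≤j j<n
    with <-≤-connex j (k + i) | <-≤-connex j (2 * m + i)
  ... | inj₁ j<k+i | _ = (L , 1 , k + i) , here refl , 1≤j , j<k+i
  ... | inj₂ k+i≤j | inj₁ j<2m+i with m≤n⇒∃[o]o+m≡n (≤-trans (m≤n+m i k) k+i≤j)
  ...   | j' , refl = covered-inside 2≤k ind' j' (+-cancelʳ-≤ i k j' k+i≤j) (+-cancelʳ-< i j' (2 * m) j<2m+i)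
  indecomposable 2≤k ind' ind'' 1≤i j 1≤j j<n | inj₂ _ | inj₂ 2m+i≤j
    with m≤n⇒∃[o]o+m≡n (≤-trans (m≤m+n (2 * m) i) 2m+i≤j)
  ... | j' , refl = covered-outside ind'' 1≤i j'
    (+-cancelʳ-≤ (2 * m) i j' (≤-trans (≤-reflexive (+-comm i (2 * m))) 2m+i≤j))
    (+-cancelʳ-< (2 * m) j' (2 * length C'') (<-≤-trans j<n (≤-reflexive (trans length-D (+-comm (2 * m) _)))))

graft : ℕ → List Chord → List Chord → List Chord
graft i C' C'' = map (shiftC' (rootEnd C') i) C' ++ map (shiftC'' i (length C')) C''

shiftC'-inner : ∀ {k i} c → 2 ≤ start c → shiftC' k i c ≡ mapEnds (_+ i) c
shiftC'-inner (_ , suc (suc _) , _) _ = refl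
shiftC'-inner (_ , 1 , _) (s≤s ())

terminalLabel-rooted : ∀ {C x} (R : Rooted C) → let open Rooted R in
  ¬ Terminal C (label , 1 , end) → TerminalLabel C x ⇔ TerminalLabelIn rest C x
terminalLabel-rooted R root-nonterminal = mk⇔ to from
  where
  open Rooted R
  to : ∀ {x} → TerminalLabel _ x → TerminalLabelIn rest _ x
  to (a , b , x∈ , t) with subst (_ ∈_) shape x∈
  ... | here refl = contradiction t root-nonterminal
  ... | there x∈rest = a , b , x∈rest , t
  from : ∀ {x} → TerminalLabelIn rest _ x → TerminalLabel _ x
  from (a , b , x∈rest , t) = a , b , subst (_ ∈_) (sym shape) (there x∈rest) , t

module _ {C' C'' : List Chord} (R' : Rooted C') {i : ℕ} where
  open Rooted R'
  private module G = Grafting label end i rest C''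

  graft-shape : graft i C' C'' ≡ G.D
  graft-shape = trans (cong (λ E → graft i E C'') shape)
    (cong (λ I → (label , 1 , end + i) ∷ I ++ G.outer)
          (map-cong-local (All.map (λ {c} (2≤a , _) → shiftC'-inner c 2≤a) rest-within)))

  graft-rooted : Rooted C'' → 1 ≤ i → i < 2 * length C'' → Rooted (graft i C' C'')
  graft-rooted R'' 1≤i i<n'' = record
    { label = label
    ; end = end + i
    ; rest = G.inner ++ G.outer
    ; shape = graft-shape
    ; end-bounds = G.end-bounds end-bounds i<n''
    ; rest-within = G.rest-within rest-within R'' i<n''
    ; indecomposable = G.indecomposable (proj₁ end-bounds) indecomposable (rooted-indecomposable R'') 1≤i
    }

  graft-root-nonterminal : Rooted C'' → 1 ≤ i → i < 2 * length C'' →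
                           ¬ Terminal (graft i C' C'') (label , 1 , end + i)
  graft-root-nonterminal R'' 1≤i i<n'' = subst (λ E → ¬ Terminal E (label , 1 , end + i)) (sym graft-shape)
    (G.root-nonterminal (proj₁ end-bounds) (proj₂ end-bounds) R'' 1≤i i<n'')

  graft-terminalLabels : ∀ {x} → TerminalLabelIn (G.inner ++ G.outer) (graft i C' C'') x ⇔
                                  (TerminalLabelIn rest C' x ⊎ TerminalLabel C'' x)
  graft-terminalLabels {x} =
    subst₂ (λ E F → TerminalLabelIn (G.inner ++ G.outer) E x ⇔ (TerminalLabelIn rest F x ⊎ TerminalLabel C'' x))
           (sym graft-shape) (sym shape) (G.terminalLabels rest-within)

length-graft : ∀ i C' C'' → length (graft i C' C'') ≡ length C' + length C''
length-graft i C' C'' = trans (length-++ (map _ C'))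
  (cong₂ _+_ (length-map (shiftC' (rootEnd C') i) C') (length-map (shiftC'' i (length C')) C''))

unique-++⁻ˡ : ∀ (A : List ℕ) {B} → Unique (A ++ B) → Unique A
unique-++⁻ˡ []      _         = []
unique-++⁻ˡ (_ ∷ A) (a∉ ∷ u) = All.++⁻ˡ A a∉ ∷ unique-++⁻ˡ A u

unique-++⁻ʳ : ∀ (A : List ℕ) {B} → Unique (A ++ B) → Unique B
unique-++⁻ʳ []      u        = u
unique-++⁻ʳ (_ ∷ A) (_ ∷ u) = unique-++⁻ʳ A u

unique-++⇒disjoint : ∀ (A : List ℕ) {B y} → Unique (A ++ B) → y ∈ A → y ∈ B → ⊥
unique-++⇒disjoint (_ ∷ A) (a∉ ∷ _) (here refl) y∈B = lookupᴬ a∉ (∈-++⁺ʳ A y∈B) refl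
unique-++⇒disjoint (_ ∷ A) (_ ∷ u)  (there y∈A) y∈B = unique-++⇒disjoint A u y∈A y∈B

unique-dropMiddle : ∀ (A : List ℕ) {L B} → Unique (A ++ L ++ B) → Unique (A ++ B)
unique-dropMiddle []      {L} u        = unique-++⁻ʳ L u
unique-dropMiddle (_ ∷ A) {L} (a∉ ∷ u) =
  All.++⁺ (All.++⁻ˡ A a∉) (All.++⁻ʳ L (All.++⁻ʳ A a∉)) ∷ unique-dropMiddle A u

∈-labelsF⁺ : ∀ {ts u y} → u ∈ ts → y ∈ labels u → y ∈ labelsF ts
∈-labelsF⁺ (here refl)         y∈u = ∈-++⁺ˡ y∈u
∈-labelsF⁺ {v ∷ _} (there u∈) y∈u = ∈-++⁺ʳ (labels v) (∈-labelsF⁺ u∈ y∈u)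

Depth⇒∈labels : ∀ {t y d} → Depth t y d → y ∈ labels t
Depth⇒∈labels root          = here refl
Depth⇒∈labels (below u∈ D) = there (∈-labelsF⁺ u∈ (Depth⇒∈labels D))

mutual
  ∈labels⇒Depth : ∀ t {y} → y ∈ labels t → ∃[ d ] Depth t y d
  ∈labels⇒Depth (node x ts) (here refl) = 0 , root
  ∈labels⇒Depth (node x ts) (there y∈) with ∈labelsF⇒Depth ts y∈
  ... | u , u∈ , d , D = suc d , below u∈ D

  ∈labelsF⇒Depth : ∀ ts {y} → y ∈ labelsF ts → Σ PTree λ u → u ∈ ts × ∃[ d ] Depth u y d
  ∈labelsF⇒Depth (u ∷ ts) y∈ with ∈-++⁻ (labels u) y∈
  ... | inj₁ y∈u  = u , here refl , ∈labels⇒Depth u y∈u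
  ... | inj₂ y∈ts with ∈labelsF⇒Depth ts y∈ts
  ...   | v , v∈ , D = v , there v∈ , D

mutual
  Depth-unique : ∀ {t y d d'} → Unique (labels t) → Depth t y d → Depth t y d' → d ≡ d'
  Depth-unique _          root          root           = refl
  Depth-unique (x∉ ∷ _) root         (below u∈ D) = ⊥-elim (lookupᴬ x∉ (∈-labelsF⁺ u∈ (Depth⇒∈labels D)) refl)
  Depth-unique (x∉ ∷ _) (below u∈ D) root         = ⊥-elim (lookupᴬ x∉ (∈-labelsF⁺ u∈ (Depth⇒∈labels D)) refl)
  Depth-unique (_ ∷ u)   (below u∈ D)  (below u∈' D') = cong suc (Depth-uniqueF u u∈ u∈' D D')

  Depth-uniqueF : ∀ {ts u u' y d d'} → Unique (labelsF ts) → u ∈ ts → u' ∈ ts →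
                  Depth u y d → Depth u' y d' → d ≡ d'
  Depth-uniqueF {u ∷ _} un (here refl) (here refl) D D' = Depth-unique (unique-++⁻ˡ (labels u) un) D D'
  Depth-uniqueF {u ∷ _} un (here refl) (there u'∈) D D' =
    ⊥-elim (unique-++⇒disjoint (labels u) un (Depth⇒∈labels D) (∈-labelsF⁺ u'∈ (Depth⇒∈labels D')))
  Depth-uniqueF {u ∷ _} un (there u∈) (here refl) D D' =
    ⊥-elim (unique-++⇒disjoint (labels u) un (Depth⇒∈labels D') (∈-labelsF⁺ u∈ (Depth⇒∈labels D)))
  Depth-uniqueF {u ∷ _} un (there u∈) (there u'∈) D D' = Depth-uniqueF (unique-++⁻ʳ (labels u) un) u∈ u'∈ D D'

ins-rootLabel : ∀ {s u i t} → Ins s u i t → rootLabel t ≡ rootLabel u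
ins-rootLabel (atNode _) = refl

ins-two-labels : ∀ {s u i t} → Ins s u i t → 2 ≤ length (labels t)
ins-two-labels {node _ _} (atNode here)                                = s≤s (s≤s z≤n)
ins-two-labels (atNode (inside {u' = node _ _} _))                   = s≤s (s≤s z≤n)
ins-two-labels (atNode (later {node _ _} _))                          = s≤s (s≤s z≤n)

mutual
  ins-labels : ∀ {s u i t} → Ins s u i t →
    Σ (List ℕ) λ A → Σ (List ℕ) λ B → labels u ≡ A ++ B × labels t ≡ A ++ labels s ++ B
  ins-labels {u = node x _} (atNode f) with insF-labels f
  ... | A , B , u≡ , t≡ = x ∷ A , B , cong (x ∷_) u≡ , cong (x ∷_) t≡

  insF-labels : ∀ {s ts i ts'} → InsF s ts i ts' →
    Σ (List ℕ) λ A → Σ (List ℕ) λ B → labelsF ts ≡ A ++ B × labelsF ts' ≡ A ++ labels s ++ B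
  insF-labels {ts = ts} here = [] , labelsF ts , refl , refl
  insF-labels {s} (inside {ts = ts} g) with ins-labels g
  ... | A , B , u≡ , u'≡ = A , B ++ labelsF ts ,
    trans (cong (_++ labelsF ts) u≡) (++-assoc A B _) ,
    trans (cong (_++ labelsF ts) u'≡) (trans (++-assoc A (labels s ++ B) _) (cong (A ++_) (++-assoc (labels s) B _)))
  insF-labels {s} (later {u} g) with insF-labels g
  ... | A , B , ts≡ , ts'≡ = labels u ++ A , B ,
    trans (cong (labels u ++_) ts≡) (sym (++-assoc (labels u) A B)) ,
    trans (cong (labels u ++_) ts'≡) (sym (++-assoc (labels u) A _))

ins-unique : ∀ {s u i t} → Ins s u i t → Unique (labels t) → Unique (labels s) × Unique (labels u)
ins-unique ins unique-t with ins-labels ins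
... | A , B , u≡ , t≡ = unique-++⁻ˡ (labels _) (unique-++⁻ʳ A unique-A++s++B) ,
                        subst Unique (sym u≡) (unique-dropMiddle A unique-A++s++B)
  where
  unique-A++s++B = subst Unique t≡ unique-t

ins-∈-graft : ∀ {s u i t y} → Ins s u i t → y ∈ labels s → y ∈ labels t
ins-∈-graft {s} {y = y} ins y∈ with ins-labels ins
... | A , B , _ , t≡ = subst (y ∈_) (sym t≡) (∈-++⁺ʳ A (∈-++⁺ˡ y∈))

ins-∈-host : ∀ {s u i t y} → Ins s u i t → y ∈ labels u → y ∈ labels t
ins-∈-host {s} {y = y} ins y∈ with ins-labels ins
... | A , B , u≡ , t≡ with ∈-++⁻ A (subst (y ∈_) u≡ y∈)
...   | inj₁ y∈A = subst (y ∈_) (sym t≡) (∈-++⁺ˡ y∈A)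
...   | inj₂ y∈B = subst (y ∈_) (sym t≡) (∈-++⁺ʳ A (∈-++⁺ʳ (labels s) y∈B))

Depth-cons : ∀ {x ts u y d} → Depth (node x ts) y (suc d) → Depth (node x (u ∷ ts)) y (suc d)
Depth-cons (below v∈ D) = below (there v∈) D

mutual
  ins-Depth-host : ∀ {s u i t y d} → Ins s u i t → Depth u y d → Depth t y d
  ins-Depth-host (atNode _) root         = root
  ins-Depth-host (atNode f) (below v∈ D) = insF-Depth-host f v∈ D

  insF-Depth-host : ∀ {s ts i ts' x v y d} → InsF s ts i ts' → v ∈ ts → Depth v y d →
                    Depth (node x ts') y (suc d)
  insF-Depth-host here       v∈          D = below (there v∈) D
  insF-Depth-host (inside g) (here refl) D = below (here refl) (ins-Depth-host g D)
  insF-Depth-host (inside g) (there v∈)  D = below (there v∈) D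
  insF-Depth-host (later g)  (here refl) D = below (here refl) D
  insF-Depth-host (later g)  (there v∈)  D = Depth-cons (insF-Depth-host g v∈ D)

mutual
  ins-Depth-graft : ∀ {s u i t} → Ins s u i t → ∃[ c ] (∀ {y d} → Depth s y d → Depth t y (c + d))
  ins-Depth-graft (atNode f) with insF-Depth-graft f
  ... | c , embed = suc c , embed

  insF-Depth-graft : ∀ {s ts i ts'} → InsF s ts i ts' →
                     ∃[ c ] (∀ {x y d} → Depth s y d → Depth (node x ts') y (suc (c + d)))
  insF-Depth-graft here = 0 , below (here refl)
  insF-Depth-graft (inside g) with ins-Depth-graft g
  ... | c , embed = c , λ D → below (here refl) (embed D)
  insF-Depth-graft (later g) with insF-Depth-graft g
  ... | c , embed = c , λ D → Depth-cons (embed D)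

ins-place-positive : ∀ {s u i t} → Ins s u i t → 1 ≤ i
ins-place-positive (atNode here)       = s≤s z≤n
ins-place-positive (atNode (inside _)) = s≤s z≤n
ins-place-positive (atNode (later _))  = s≤s z≤n

mutual
  ins-place-bounded : ∀ {s u i t} → Ins s u i t → i ≤ rtips u
  ins-place-bounded (atNode f) = insF-place-bounded f

  insF-place-bounded : ∀ {s ts i ts'} → InsF s ts i ts' → i ≤ rtipsF ts
  insF-place-bounded {ts = []}    here = ≤-refl
  insF-place-bounded {ts = _ ∷ _} here = s≤s z≤n
  insF-place-bounded (inside {u} {ts = ts} g) = s≤s (≤-trans (ins-place-bounded g) (m≤m+n (rtips u) (rtipsF ts)))
  insF-place-bounded (later {u} g) = s≤s (+-monoʳ-≤ (rtips u) (insF-place-bounded g))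

mutual
  ins-rtips : ∀ {s u i t} → Ins s u i t → rtips t ≡ rtips u + suc (rtips s)
  ins-rtips (atNode f) = insF-rtips f

  insF-rtips : ∀ {s ts i ts'} → InsF s ts i ts' → rtipsF ts' ≡ rtipsF ts + suc (rtips s)
  insF-rtips {s} {ts} here = trans (cong suc (+-comm (rtips s) (rtipsF ts))) (sym (+-suc (rtipsF ts) (rtips s)))
  insF-rtips {s} (inside {u} {u'} {ts} g) = cong suc (begin
    rtips u' + rtipsF ts                  ≡⟨ cong (_+ rtipsF ts) (ins-rtips g) ⟩
    rtips u + suc (rtips s) + rtipsF ts  ≡⟨ +-assoc (rtips u) _ (rtipsF ts) ⟩
    rtips u + (suc (rtips s) + rtipsF ts) ≡⟨ cong (rtips u +_) (+-comm _ (rtipsF ts)) ⟩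
    rtips u + (rtipsF ts + suc (rtips s)) ≡⟨ +-assoc (rtips u) (rtipsF ts) _ ⟨
    rtips u + rtipsF ts + suc (rtips s)  ∎)
    where open ≡-Reasoning
  insF-rtips {s} (later {u} {ts} g) =
    cong suc (trans (cong (rtips u +_) (insF-rtips g)) (sym (+-assoc (rtips u) (rtipsF ts) _)))

TubeRoot : ∀ {t} → BinTubing t → ℕ → Set
TubeRoot {t} τ x = Σ (List ℕ) λ T → T ∈ tubes τ × 2 ≤ length T × IsTubeRoot t T x

¬tubeRoot-single : ∀ {x y} → ¬ TubeRoot (single x) y
¬tubeRoot-single (_ , here refl , s≤s () , _)

tube⊆labels : ∀ {t} (τ : BinTubing t) {T y} → T ∈ tubes τ → y ∈ T → y ∈ labels t
tube⊆labels (single _)         (here refl) y∈ = y∈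
tube⊆labels (split _ _ _)      (here refl) y∈ = y∈
tube⊆labels (split ins τ' τ'') (there T∈)  y∈ with ∈-++⁻ (tubes τ') T∈
... | inj₁ T∈τ'  = ins-∈-graft ins (tube⊆labels τ' T∈τ' y∈)
... | inj₂ T∈τ'' = ins-∈-host ins (tube⊆labels τ'' T∈τ'' y∈)

module DepthEmbedding {u t : PTree} (c : ℕ) (embed : ∀ {y d} → Depth u y d → Depth t y (c + d))
                      (unique-t : Unique (labels t)) where

  isTubeRoot⁺ : ∀ {T x} → (∀ {y} → y ∈ T → y ∈ labels u) → IsTubeRoot u T x → IsTubeRoot t T x
  isTubeRoot⁺ T⊆u (x∈T , dx , Dx , minimal) = x∈T , c + dx , embed Dx , minimal-t
    where
    minimal-t : ∀ y dy → y ∈ _ → Depth t y dy → c + dx ≤ dy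
    minimal-t y dy y∈T Dy with ∈labels⇒Depth u (T⊆u y∈T)
    ... | dy' , Dy' = subst (c + dx ≤_) (Depth-unique unique-t (embed Dy') Dy) (+-monoʳ-≤ c (minimal y dy' y∈T Dy'))

  isTubeRoot⁻ : ∀ {T x} → (∀ {y} → y ∈ T → y ∈ labels u) → IsTubeRoot t T x → IsTubeRoot u T x
  isTubeRoot⁻ T⊆u (x∈T , dx , Dx , minimal) with ∈labels⇒Depth u (T⊆u x∈T)
  ... | dx' , Dx' = x∈T , dx' , Dx' , λ y dy' y∈T Dy' →
    +-cancelˡ-≤ c dx' dy' (subst (_≤ c + dy') (Depth-unique unique-t Dx (embed Dx'))
                                 (minimal y (c + dy') y∈T (embed Dy')))

Depth-zero : ∀ {t x d} → Depth t x d → d ≤ 0 → x ≡ rootLabel t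
Depth-zero root _ = refl

isTubeRoot-labels⇒root : ∀ {t x} → IsTubeRoot t (labels t) x → x ≡ rootLabel t
isTubeRoot-labels⇒root {node r _} (_ , _ , Dx , minimal) = Depth-zero Dx (minimal r 0 (here refl) root)

isTubeRoot-labels-root : ∀ t → IsTubeRoot t (labels t) (rootLabel t)
isTubeRoot-labels-root (node _ _) = here refl , 0 , root , λ _ _ _ _ → z≤n

tubeRoot-split-root : ∀ {t' t'' i t} (ins : Ins t' t'' i t) τ' τ'' → TubeRoot (split ins τ' τ'') (rootLabel t)
tubeRoot-split-root {t = t} ins _ _ = labels t , here refl , ins-two-labels ins , isTubeRoot-labels-root t

tubeRoot-split : ∀ {t' t'' i t x} (ins : Ins t' t'' i t) τ' τ'' → Unique (labels t) →
  (x ≡ rootLabel t ⊎ TubeRoot (split ins τ' τ'') x) ⇔ (TubeRoot τ' x ⊎ (x ≡ rootLabel t'' ⊎ TubeRoot τ'' x))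
tubeRoot-split {t'' = t''} {t = t} ins τ' τ'' unique-t = mk⇔ to from
  where
  module Graft = DepthEmbedding (proj₁ (ins-Depth-graft ins)) (proj₂ (ins-Depth-graft ins)) unique-t
  module Host  = DepthEmbedding 0 (ins-Depth-host ins) unique-t
  to : ∀ {x} → x ≡ rootLabel t ⊎ TubeRoot (split ins τ' τ'') x →
                TubeRoot τ' x ⊎ (x ≡ rootLabel t'' ⊎ TubeRoot τ'' x)
  to (inj₁ x≡r) = inj₂ (inj₁ (trans x≡r (ins-rootLabel ins)))
  to (inj₂ (_ , here refl , _ , root-T)) = inj₂ (inj₁ (trans (isTubeRoot-labels⇒root root-T) (ins-rootLabel ins)))
  to (inj₂ (T , there T∈ , 2≤ , root-T)) with ∈-++⁻ (tubes τ') T∈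
  ... | inj₁ T∈τ'  = inj₁ (T , T∈τ' , 2≤ , Graft.isTubeRoot⁻ (tube⊆labels τ' T∈τ') root-T)
  ... | inj₂ T∈τ'' = inj₂ (inj₂ (T , T∈τ'' , 2≤ , Host.isTubeRoot⁻ (tube⊆labels τ'' T∈τ'') root-T))
  from : ∀ {x} → TubeRoot τ' x ⊎ (x ≡ rootLabel t'' ⊎ TubeRoot τ'' x) →
                  x ≡ rootLabel t ⊎ TubeRoot (split ins τ' τ'') x
  from (inj₁ (T , T∈τ' , 2≤ , root-T)) =
    inj₂ (T , there (∈-++⁺ˡ T∈τ') , 2≤ , Graft.isTubeRoot⁺ (tube⊆labels τ' T∈τ') root-T)
  from (inj₂ (inj₁ x≡r)) = inj₁ (trans x≡r (sym (ins-rootLabel ins)))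
  from (inj₂ (inj₂ (T , T∈τ'' , 2≤ , root-T))) =
    inj₂ (T , there (∈-++⁺ʳ (tubes τ') T∈τ'') , 2≤ , Host.isTubeRoot⁺ (tube⊆labels τ'' T∈τ'') root-T)

θ-length : ∀ {t} (τ : BinTubing t) → 2 * length (θ τ) ≡ suc (rtips t)
θ-length (single _) = refl
θ-length (split {t'} {t''} {i} {t} ins τ' τ'') = begin
  2 * length (graft i (θ τ') (θ τ''))          ≡⟨ cong (2 *_) (length-graft i (θ τ') (θ τ'')) ⟩
  2 * (length (θ τ') + length (θ τ''))          ≡⟨ *-distribˡ-+ 2 (length (θ τ')) (length (θ τ'')) ⟩
  2 * length (θ τ') + 2 * length (θ τ'')        ≡⟨ cong₂ _+_ (θ-length τ') (θ-length τ'') ⟩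
  suc (rtips t') + suc (rtips t'')              ≡⟨ +-comm (suc (rtips t')) (suc (rtips t'')) ⟩
  suc (rtips t'' + suc (rtips t'))              ≡⟨ cong suc (ins-rtips ins) ⟨
  suc (rtips t)                                 ∎
  where open ≡-Reasoning

θ-place-bounded : ∀ {t' t'' i t} → Ins t' t'' i t → (τ'' : BinTubing t'') → i < 2 * length (θ τ'')
θ-place-bounded {i = i} ins τ'' = subst (i <_) (sym (θ-length τ'')) (s≤s (ins-place-bounded ins))

single-indecomposable : ∀ x → Indecomposable [ x , 1 , 2 ]
single-indecomposable x 1 _ _ = (x , 1 , 2) , here refl , ≤-refl , ≤-refl
single-indecomposable x (suc (suc _)) _ (s≤s (s≤s ()))

θ-rooted : ∀ {t} (τ : BinTubing t) → Rooted (θ τ)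
θ-rooted (single x) = record
  { label = x ; end = 2 ; rest = [] ; shape = refl
  ; end-bounds = ≤-refl , ≤-refl ; rest-within = [] ; indecomposable = single-indecomposable x }
θ-rooted (split ins τ' τ'') =
  graft-rooted (θ-rooted τ') (θ-rooted τ'') (ins-place-positive ins) (θ-place-bounded ins τ'')

θ-split-terminalLabel : ∀ {t' t'' i t x} (ins : Ins t' t'' i t) τ' τ'' →
  TerminalLabel (θ (split ins τ' τ'')) x ⇔
  TerminalLabelIn (Rooted.rest (θ-rooted (split ins τ' τ''))) (θ (split ins τ' τ'')) x
θ-split-terminalLabel ins τ' τ'' = terminalLabel-rooted (θ-rooted (split ins τ' τ''))
  (graft-root-nonterminal (θ-rooted τ') (θ-rooted τ'') (ins-place-positive ins) (θ-place-bounded ins τ''))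

θ-nonRoot-terminalLabels : ∀ {t} (τ : BinTubing t) →
  (∀ x → TerminalLabel (θ τ) x ⇔ (x ≡ rootLabel t ⊎ TubeRoot τ x)) →
  ∀ x → TerminalLabelIn (Rooted.rest (θ-rooted τ)) (θ τ) x ⇔ TubeRoot τ x
θ-nonRoot-terminalLabels (single _) _ _ = mk⇔ (λ { (_ , _ , () , _) }) (λ r → ⊥-elim (¬tubeRoot-single r))
θ-nonRoot-terminalLabels (split ins τ' τ'') θ-terminal x =
  ⇔-trans (⇔-sym (θ-split-terminalLabel ins τ' τ''))
    (⇔-trans (θ-terminal x) (mk⇔ (λ { (inj₁ refl) → tubeRoot-split-root ins τ' τ'' ; (inj₂ r) → r }) inj₂))

θ-terminalLabels : ∀ {t} → Unique (labels t) → (τ : BinTubing t) →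
  ∀ x → TerminalLabel (θ τ) x ⇔ (x ≡ rootLabel t ⊎ TubeRoot τ x)
θ-terminalLabels _ (single y) x = mk⇔ to from
  where
  to : TerminalLabel [ y , 1 , 2 ] x → x ≡ y ⊎ TubeRoot (single y) x
  to (_ , _ , here refl , _) = inj₁ refl
  from : x ≡ y ⊎ TubeRoot (single y) x → TerminalLabel [ y , 1 , 2 ] x
  from (inj₁ refl) = 1 , 2 , here refl , terminal-[ y , 1 , 2 ] (y , 1 , 2) ≤-refl
  from (inj₂ r)    = ⊥-elim (¬tubeRoot-single r)
θ-terminalLabels {t} unique-t (split {t'} {t''} ins τ' τ'') x = begin
  TerminalLabel (θ (split ins τ' τ'')) x
    ∼⟨ θ-split-terminalLabel ins τ' τ'' ⟩
  TerminalLabelIn (Rooted.rest (θ-rooted (split ins τ' τ''))) (θ (split ins τ' τ'')) x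
    ∼⟨ graft-terminalLabels (θ-rooted τ') ⟩
  (TerminalLabelIn (Rooted.rest (θ-rooted τ')) (θ τ') x ⊎ TerminalLabel (θ τ'') x)
    ∼⟨ θ-nonRoot-terminalLabels τ' (θ-terminalLabels unique-t' τ') x ⊎-⇔ θ-terminalLabels unique-t'' τ'' x ⟩
  (TubeRoot τ' x ⊎ (x ≡ rootLabel t'' ⊎ TubeRoot τ'' x))
    ∼⟨ ⇔-sym (tubeRoot-split ins τ' τ'' unique-t) ⟩
  (x ≡ rootLabel t ⊎ TubeRoot (split ins τ' τ'') x)
    ∎
  where
  open EquationalReasoning
  unique-t' : Unique (labels t')
  unique-t' = proj₁ (ins-unique ins unique-t)
  unique-t'' : Unique (labels t'')
  unique-t'' = proj₂ (ins-unique ins unique-t)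

lemma5p19 : (t : PTree) → Unique (labels t) → (τ : BinTubing t) → (x : ℕ) →
    (TerminalLabel (θ τ) x →
       x ≡ rootLabel t ⊎ Σ (List ℕ) (λ T → T ∈ tubes τ × 2 ≤ length T × IsTubeRoot t T x))
    × (x ≡ rootLabel t ⊎ Σ (List ℕ) (λ T → T ∈ tubes τ × 2 ≤ length T × IsTubeRoot t T x) →
       TerminalLabel (θ τ) x)
lemma5p19 t unique-t τ x = Equivalence.to correspondence , Equivalence.from correspondence
  where
  correspondence : TerminalLabel (θ τ) x ⇔ (x ≡ rootLabel t ⊎ TubeRoot τ x)
  correspondence = θ-terminalLabels unique-t τ x
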